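{- (i) Let $(P,\leq,{}',0,1)$ be a pseudo-orthomodular poset and define $M(x,y)=L(U(x,y'),y)$ and $R(x,y)=L(U(L(y,x),x'))$ for $x,y\in P$. Then for all $x,y\in P$, $L((M(y',x))')=R(x,y)$ and $L((R(y,x'))')=M(x,y)$. (ii) Let $(P,\leq,{}',0,1)$ be a poset with complementation and define $M(x,y)=L(x,y)$ and $R(x,y)=L(U(y,x'))$ for $x,y\in P$. Then for all $x,y\in P$, $L((M(y',x))')=R(x,y)$ and $L((R(y,x'))')=M(x,y)$.
   Context: For a poset $(P,\leq)$ and $A\subseteq P$ let $L(A)=\{x\in P\mid x\leq a\text{ for all }a\in A\}$ and $U(A)=\{x\in P\mid a\leq x\text{ for all }a\in A\}$; write $L(x)=L(\{x\})$, and when several elements or subsets are listed as arguments the union of them is meant, e.g. $L(x,y)=L(\{x,y\})$, $L(U(x,y'),y)=L(U(\{x,y'\})\cup\{y\})$. For $A\subseteq P$, $A'=\{a'\mid a\in A\}$. A poset with complementation is $(P,\leq,{}',0,1)$ where $(P,\leq,0,1)$ is a bounded poset and ${}'$ is a unary operation with $L(x,x')=\{0\}$, $U(x,x')=\{1\}$, $x\leq y\Rightarrow y'\leq x'$, and $x''=x$ for all $x,y$. It is pseudo-orthomodular if $L(U(L(x,y),y'),y)=L(x,y)$ for all $x,y\in P$. -}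

module Defs where

open import Level using (Level; _⊔_; suc)
open import Data.Product using (Σ; _×_; _,_)
open import Data.Sum using (_⊎_)
open import Relation.Binary.Bundles using (Poset)

Subset : ∀ {a} (A : Set a) (ℓ : Level) → Set (a ⊔ suc ℓ)
Subset A ℓ = A → Set ℓ

module PosetNotions {c ℓ₁ ℓ₂} (P : Poset c ℓ₁ ℓ₂) where
  open Poset P renaming (Carrier to X)

  Sub : Set (suc (c ⊔ ℓ₁ ⊔ ℓ₂))
  Sub = Subset X (c ⊔ ℓ₁ ⊔ ℓ₂)

  ⟦_⟧ : X → Sub
  ⟦ x ⟧ z = Lift' (z ≈ x)
    where
    open import Level using () renaming (Lift to L')
    Lift' : Set ℓ₁ → Set (c ⊔ ℓ₁ ⊔ ℓ₂)
    Lift' S = L' (c ⊔ ℓ₁ ⊔ ℓ₂) S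

  _∪_ : Sub → Sub → Sub
  (A ∪ B) z = A z ⊎ B z

  L : Sub → Sub
  L A x = ∀ a → A a → x ≤ a

  U : Sub → Sub
  U A x = ∀ a → A a → a ≤ x

  _≐_ : Sub → Sub → Set (c ⊔ ℓ₁ ⊔ ℓ₂)
  A ≐ B = (∀ z → A z → B z) × (∀ z → B z → A z)

record ComplementedPoset c ℓ₁ ℓ₂ : Set (suc (c ⊔ ℓ₁ ⊔ ℓ₂)) where
  field
    poset : Poset c ℓ₁ ℓ₂
  open Poset poset public renaming (Carrier to X)
  open PosetNotions poset public
  field
    _′ : X → X
    𝟎 𝟏 : X
    ′-cong : ∀ {x y} → x ≈ y → (x ′) ≈ (y ′)
    𝟎-least : ∀ x → 𝟎 ≤ x
    𝟏-greatest : ∀ x → x ≤ 𝟏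
    L-compl : ∀ x → L (⟦ x ⟧ ∪ ⟦ x ′ ⟧) ≐ ⟦ 𝟎 ⟧
    U-compl : ∀ x → U (⟦ x ⟧ ∪ ⟦ x ′ ⟧) ≐ ⟦ 𝟏 ⟧
    ′-antitone : ∀ {x y} → x ≤ y → (y ′) ≤ (x ′)
    ′-involutive : ∀ x → ((x ′) ′) ≈ x

  _ᶜ : Sub → Sub
  (A ᶜ) z = Σ X (λ a → A a × (z ≈ (a ′)))

  IsPseudoOrthomodular : Set (c ⊔ ℓ₁ ⊔ ℓ₂)
  IsPseudoOrthomodular =
    ∀ x y → L (U (L (⟦ x ⟧ ∪ ⟦ y ⟧) ∪ ⟦ y ′ ⟧) ∪ ⟦ y ⟧) ≐ L (⟦ x ⟧ ∪ ⟦ y ⟧)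

  Mᵢ : X → X → Sub
  Mᵢ x y = L (U (⟦ x ⟧ ∪ ⟦ y ′ ⟧) ∪ ⟦ y ⟧)

  Rᵢ : X → X → Sub
  Rᵢ x y = L (U (L (⟦ y ⟧ ∪ ⟦ x ⟧) ∪ ⟦ x ′ ⟧))

  Mᵢᵢ : X → X → Sub
  Mᵢᵢ x y = L (⟦ x ⟧ ∪ ⟦ y ⟧)

  Rᵢᵢ : X → X → Sub
  Rᵢᵢ x y = L (U (⟦ y ⟧ ∪ ⟦ x ′ ⟧))

-- Complementation is an antitone involution, so it exchanges lower and upper
-- cones: L(A)' = U(A') and U(A)' = L(A'). Each identity is therefore obtained by
-- pushing ' through the cones of M or R (turning L(B)' into U(B')), cancelling
-- double complements, and in two cases closing with L(U(L(A))) = L(A).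
module Submission where

open import Defs
open import Data.Product using (_×_; _,_)
open import Data.Sum using (inj₁; inj₂)
open import Level using (lift; _⊔_) renaming (suc to lsuc)
open import Relation.Binary.Bundles using (Setoid)
import Relation.Binary.Reasoning.Setoid as SetoidReasoning

module ConeDuality {c ℓ₁ ℓ₂} (P : ComplementedPoset c ℓ₁ ℓ₂) where
  open ComplementedPoset P

  infix 4 _⊆_

  _⊆_ : Sub → Sub → Set (c ⊔ ℓ₁ ⊔ ℓ₂)
  A ⊆ B = ∀ z → A z → B z

  ≐-refl : ∀ {A} → A ≐ A
  ≐-refl = (λ _ a → a) , (λ _ a → a)

  ≐-sym : ∀ {A B} → A ≐ B → B ≐ A
  ≐-sym (A⊆B , B⊆A) = B⊆A , A⊆B

  ≐-trans : ∀ {A B C} → A ≐ B → B ≐ C → A ≐ C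
  ≐-trans (A⊆B , B⊆A) (B⊆C , C⊆B) =
    (λ z a → B⊆C z (A⊆B z a)) , (λ z c → B⊆A z (C⊆B z c))

  ≐-setoid : Setoid (lsuc (c ⊔ ℓ₁ ⊔ ℓ₂)) (c ⊔ ℓ₁ ⊔ ℓ₂)
  ≐-setoid = record
    { Carrier       = Sub
    ; _≈_           = _≐_
    ; isEquivalence = record { refl = ≐-refl ; sym = ≐-sym ; trans = ≐-trans }
    }

  ′-antitone-involutive : ∀ {x y} → x ≤ y ′ → y ≤ x ′
  ′-antitone-involutive {y = y} x≤y′ =
    ≤-respˡ-≈ (′-involutive y) (′-antitone x≤y′)

  ′-involutive-antitone : ∀ {x y} → x ′ ≤ y → y ′ ≤ x
  ′-involutive-antitone {x} x′≤y = ≤-respʳ-≈ (′-involutive x) (′-antitone x′≤y)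

  L-antitone : ∀ {A B} → A ⊆ B → L B ⊆ L A
  L-antitone A⊆B z z∈LB a a∈A = z∈LB a (A⊆B a a∈A)

  U-antitone : ∀ {A B} → A ⊆ B → U B ⊆ U A
  U-antitone A⊆B z z∈UB a a∈A = z∈UB a (A⊆B a a∈A)

  L-cong : ∀ {A B} → A ≐ B → L A ≐ L B
  L-cong (A⊆B , B⊆A) = L-antitone B⊆A , L-antitone A⊆B

  U-cong : ∀ {A B} → A ≐ B → U A ≐ U B
  U-cong (A⊆B , B⊆A) = U-antitone B⊆A , U-antitone A⊆B

  ∪-cong : ∀ {A B C D} → A ≐ C → B ≐ D → (A ∪ B) ≐ (C ∪ D)
  ∪-cong (A⊆C , C⊆A) (B⊆D , D⊆B) =
    (λ { z (inj₁ a) → inj₁ (A⊆C z a) ; z (inj₂ b) → inj₂ (B⊆D z b) }) ,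
    (λ { z (inj₁ c) → inj₁ (C⊆A z c) ; z (inj₂ d) → inj₂ (D⊆B z d) })

  ᶜ-∪ : ∀ A B → ((A ∪ B) ᶜ) ≐ ((A ᶜ) ∪ (B ᶜ))
  ᶜ-∪ A B =
    (λ { z (a , inj₁ a∈A , z≈a′) → inj₁ (a , a∈A , z≈a′)
       ; z (b , inj₂ b∈B , z≈b′) → inj₂ (b , b∈B , z≈b′) }) ,
    (λ { z (inj₁ (a , a∈A , z≈a′)) → a , inj₁ a∈A , z≈a′
       ; z (inj₂ (b , b∈B , z≈b′)) → b , inj₂ b∈B , z≈b′ })

  ⟦⟧ᶜ : ∀ x → (⟦ x ⟧ ᶜ) ≐ ⟦ x ′ ⟧
  ⟦⟧ᶜ x =
    (λ { z (a , lift a≈x , z≈a′) → lift (Eq.trans z≈a′ (′-cong a≈x)) }) ,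
    (λ { z (lift z≈x′) → x , lift Eq.refl , z≈x′ })

  ⟦′⟧ᶜ : ∀ x → (⟦ x ′ ⟧ ᶜ) ≐ ⟦ x ⟧
  ⟦′⟧ᶜ x =
    (λ { z (a , lift a≈x′ , z≈a′) →
           lift (Eq.trans z≈a′ (Eq.trans (′-cong a≈x′) (′-involutive x))) }) ,
    (λ { z (lift z≈x) → x ′ , lift Eq.refl , Eq.trans z≈x (Eq.sym (′-involutive x)) })

  L-ᶜ : ∀ A → (L A ᶜ) ≐ U (A ᶜ)
  L-ᶜ A =
    (λ { z (a , a∈LA , z≈a′) w (b , b∈A , w≈b′) →
           ≤-respˡ-≈ (Eq.sym w≈b′) (≤-respʳ-≈ (Eq.sym z≈a′) (′-antitone (a∈LA b b∈A))) }) ,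
    (λ z z∈UAᶜ → z ′ ,
       (λ b b∈A → ′-involutive-antitone (z∈UAᶜ (b ′) (b , b∈A , Eq.refl))) ,
       Eq.sym (′-involutive z))

  U-ᶜ : ∀ A → (U A ᶜ) ≐ L (A ᶜ)
  U-ᶜ A =
    (λ { z (a , a∈UA , z≈a′) w (b , b∈A , w≈b′) →
           ≤-respˡ-≈ (Eq.sym z≈a′) (≤-respʳ-≈ (Eq.sym w≈b′) (′-antitone (a∈UA b b∈A))) }) ,
    (λ z z∈LAᶜ → z ′ ,
       (λ b b∈A → ′-antitone-involutive (z∈LAᶜ (b ′) (b , b∈A , Eq.refl))) ,
       Eq.sym (′-involutive z))

  L-U-L : ∀ A → L (U (L A)) ≐ L A
  L-U-L A =
    (λ z z∈LULA a a∈A → z∈LULA a (λ w w∈LA → w∈LA a a∈A)) ,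
    (λ z z∈LA u u∈ULA → u∈ULA z z∈LA)

  ⟦′⟧∪⟦′⟧ᶜ : ∀ x y → ((⟦ x ′ ⟧ ∪ ⟦ y ′ ⟧) ᶜ) ≐ (⟦ x ⟧ ∪ ⟦ y ⟧)
  ⟦′⟧∪⟦′⟧ᶜ x y = ≐-trans (ᶜ-∪ ⟦ x ′ ⟧ ⟦ y ′ ⟧) (∪-cong (⟦′⟧ᶜ x) (⟦′⟧ᶜ y))

  open SetoidReasoning ≐-setoid

  Mᵢ-duality : ∀ x y → L (Mᵢ (y ′) x ᶜ) ≐ Rᵢ x y
  Mᵢ-duality x y = begin
    L (Mᵢ (y ′) x ᶜ)
      ≈⟨ L-cong (L-ᶜ _) ⟩
    L (U ((U (⟦ y ′ ⟧ ∪ ⟦ x ′ ⟧) ∪ ⟦ x ⟧) ᶜ))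
      ≈⟨ L-cong (U-cong (ᶜ-∪ _ _)) ⟩
    L (U ((U (⟦ y ′ ⟧ ∪ ⟦ x ′ ⟧) ᶜ) ∪ (⟦ x ⟧ ᶜ)))
      ≈⟨ L-cong (U-cong (∪-cong (U-ᶜ _) (⟦⟧ᶜ x))) ⟩
    L (U (L ((⟦ y ′ ⟧ ∪ ⟦ x ′ ⟧) ᶜ) ∪ ⟦ x ′ ⟧))
      ≈⟨ L-cong (U-cong (∪-cong (L-cong (⟦′⟧∪⟦′⟧ᶜ y x)) ≐-refl)) ⟩
    Rᵢ x y ∎

  Rᵢ-duality : ∀ x y → L (Rᵢ y (x ′) ᶜ) ≐ Mᵢ x y
  Rᵢ-duality x y = begin
    L (Rᵢ y (x ′) ᶜ)
      ≈⟨ L-cong (L-ᶜ _) ⟩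
    L (U (U (L (⟦ x ′ ⟧ ∪ ⟦ y ⟧) ∪ ⟦ y ′ ⟧) ᶜ))
      ≈⟨ L-cong (U-cong (U-ᶜ _)) ⟩
    L (U (L ((L (⟦ x ′ ⟧ ∪ ⟦ y ⟧) ∪ ⟦ y ′ ⟧) ᶜ)))
      ≈⟨ L-U-L _ ⟩
    L ((L (⟦ x ′ ⟧ ∪ ⟦ y ⟧) ∪ ⟦ y ′ ⟧) ᶜ)
      ≈⟨ L-cong (ᶜ-∪ _ _) ⟩
    L ((L (⟦ x ′ ⟧ ∪ ⟦ y ⟧) ᶜ) ∪ (⟦ y ′ ⟧ ᶜ))
      ≈⟨ L-cong (∪-cong (L-ᶜ _) (⟦′⟧ᶜ y)) ⟩
    L (U ((⟦ x ′ ⟧ ∪ ⟦ y ⟧) ᶜ) ∪ ⟦ y ⟧)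
      ≈⟨ L-cong (∪-cong (U-cong (ᶜ-∪ _ _)) ≐-refl) ⟩
    L (U ((⟦ x ′ ⟧ ᶜ) ∪ (⟦ y ⟧ ᶜ)) ∪ ⟦ y ⟧)
      ≈⟨ L-cong (∪-cong (U-cong (∪-cong (⟦′⟧ᶜ x) (⟦⟧ᶜ y))) ≐-refl) ⟩
    Mᵢ x y ∎

  Mᵢᵢ-duality : ∀ x y → L (Mᵢᵢ (y ′) x ᶜ) ≐ Rᵢᵢ x y
  Mᵢᵢ-duality x y = begin
    L (Mᵢᵢ (y ′) x ᶜ)
      ≈⟨ L-cong (L-ᶜ _) ⟩
    L (U ((⟦ y ′ ⟧ ∪ ⟦ x ⟧) ᶜ))
      ≈⟨ L-cong (U-cong (≐-trans (ᶜ-∪ _ _) (∪-cong (⟦′⟧ᶜ y) (⟦⟧ᶜ x)))) ⟩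
    Rᵢᵢ x y ∎

  Rᵢᵢ-duality : ∀ x y → L (Rᵢᵢ y (x ′) ᶜ) ≐ Mᵢᵢ x y
  Rᵢᵢ-duality x y = begin
    L (Rᵢᵢ y (x ′) ᶜ)
      ≈⟨ L-cong (L-ᶜ _) ⟩
    L (U (U (⟦ x ′ ⟧ ∪ ⟦ y ′ ⟧) ᶜ))
      ≈⟨ L-cong (U-cong (U-ᶜ _)) ⟩
    L (U (L ((⟦ x ′ ⟧ ∪ ⟦ y ′ ⟧) ᶜ)))
      ≈⟨ L-U-L _ ⟩
    L ((⟦ x ′ ⟧ ∪ ⟦ y ′ ⟧) ᶜ)
      ≈⟨ L-cong (⟦′⟧∪⟦′⟧ᶜ x y) ⟩
    Mᵢᵢ x y ∎

open ComplementedPoset using (IsPseudoOrthomodular; _≐_; L; _ᶜ; Mᵢ; Rᵢ; Mᵢᵢ; Rᵢᵢ; _′; X)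

proposition1 : ∀ {c ℓ₁ ℓ₂}
    → ((P : ComplementedPoset c ℓ₁ ℓ₂) → IsPseudoOrthomodular P
    → (x y : X P)
    → (_≐_ P (L P (_ᶜ P (Mᵢ P (_′ P y) x))) (Rᵢ P x y))
    × (_≐_ P (L P (_ᶜ P (Rᵢ P y (_′ P x)))) (Mᵢ P x y)))
    × ((P : ComplementedPoset c ℓ₁ ℓ₂)
    → (x y : X P)
    → (_≐_ P (L P (_ᶜ P (Mᵢᵢ P (_′ P y) x))) (Rᵢᵢ P x y))
    × (_≐_ P (L P (_ᶜ P (Rᵢᵢ P y (_′ P x)))) (Mᵢᵢ P x y)))
proposition1 =
  (λ P _ x y → Mᵢ-duality P x y , Rᵢ-duality P x y) ,
  (λ P x y → Mᵢᵢ-duality P x y , Rᵢᵢ-duality P x y)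
  where open ConeDuality
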